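{- Let $G$ be a graph containing a triangle, and let $G_0$ be the graph obtained from $G$ by removing two of the edges of that triangle (keeping all vertices). Then $\theta(G_0)\ge\theta(G)-1$.
   Context: All graphs are finite, simple and undirected. A clique cover of $G=(V,E)$ is a family of vertex sets, each inducing a clique, whose union is $V$ and such that every edge lies in some member. $\theta(G)$ is the minimum size of a clique cover of $G$. -}

module Defs where

open import Data.Nat using (ℕ; _≤_)
import Data.Bool.Properties
open import Data.Bool using (Bool; true; false; _∧_; not)
open import Data.Fin using (Fin; _≟_)
open import Data.Fin.Subset using (Subset; _∈_)
open import Data.List using (List; length)
open import Data.List.Membership.Propositional renaming (_∈_ to _∈ₗ_)
open import Data.Product using (Σ; ∃; _×_; _,_)
open import Relation.Binary.PropositionalEquality using (_≡_; _≢_)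
open import Relation.Nullary.Decidable using (⌊_⌋)

record Graph (n : ℕ) : Set where
  field
    adj   : Fin n → Fin n → Bool
    sym   : ∀ u v → adj u v ≡ adj v u
    irrefl : ∀ v → adj v v ≡ false

open Graph public

Adj : ∀ {n} → Graph n → Fin n → Fin n → Set
Adj G u v = adj G u v ≡ true

IsClique : ∀ {n} → Graph n → Subset n → Set
IsClique G S = ∀ u v → u ∈ S → v ∈ S → u ≢ v → Adj G u v

record IsCliqueCover {n} (G : Graph n) (𝒞 : List (Subset n)) : Set where
  field
    cliques     : ∀ S → S ∈ₗ 𝒞 → IsClique G S
    coversVerts : ∀ v → ∃ λ S → S ∈ₗ 𝒞 × v ∈ S
    coversEdges : ∀ u v → Adj G u v → ∃ λ S → S ∈ₗ 𝒞 × u ∈ S × v ∈ S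

IsTheta : ∀ {n} → Graph n → ℕ → Set
IsTheta G m =
  (∃ λ 𝒞 → IsCliqueCover G 𝒞 × length 𝒞 ≡ m) ×
  (∀ 𝒞 → IsCliqueCover G 𝒞 → m ≤ length 𝒞)

removeTwo : ∀ {n} → Graph n → Fin n → Fin n → Fin n → Graph n
removeTwo {n} G a b c = record
  { adj = adj'
  ; sym = sym'
  ; irrefl = irr' }
  where
  isAB : Fin n → Fin n → Bool
  isAB u v = (⌊ u ≟ a ⌋ ∧ ⌊ v ≟ b ⌋) Data.Bool.∨ (⌊ u ≟ b ⌋ ∧ ⌊ v ≟ a ⌋)
  isAC : Fin n → Fin n → Bool
  isAC u v = (⌊ u ≟ a ⌋ ∧ ⌊ v ≟ c ⌋) Data.Bool.∨ (⌊ u ≟ c ⌋ ∧ ⌊ v ≟ a ⌋)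
  adj' : Fin n → Fin n → Bool
  adj' u v = adj G u v ∧ not (isAB u v Data.Bool.∨ isAC u v)
  orc : ∀ x y → (x Data.Bool.∨ y) ≡ (y Data.Bool.∨ x)
  orc false false = Relation.Binary.PropositionalEquality.refl
  orc false true = Relation.Binary.PropositionalEquality.refl
  orc true false = Relation.Binary.PropositionalEquality.refl
  orc true true = Relation.Binary.PropositionalEquality.refl
  sym' : ∀ u v → adj' u v ≡ adj' v u
  sym' u v rewrite sym G u v
    | orc (⌊ u ≟ a ⌋ ∧ ⌊ v ≟ b ⌋) (⌊ u ≟ b ⌋ ∧ ⌊ v ≟ a ⌋)
    | orc (⌊ u ≟ a ⌋ ∧ ⌊ v ≟ c ⌋) (⌊ u ≟ c ⌋ ∧ ⌊ v ≟ a ⌋)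
    | Data.Bool.Properties.∧-comm ⌊ u ≟ b ⌋ ⌊ v ≟ a ⌋
    | Data.Bool.Properties.∧-comm ⌊ u ≟ a ⌋ ⌊ v ≟ b ⌋
    | Data.Bool.Properties.∧-comm ⌊ u ≟ c ⌋ ⌊ v ≟ a ⌋
    | Data.Bool.Properties.∧-comm ⌊ u ≟ a ⌋ ⌊ v ≟ c ⌋
    = Relation.Binary.PropositionalEquality.refl
  irr' : ∀ v → adj' v v ≡ false
  irr' v rewrite irrefl G v = Relation.Binary.PropositionalEquality.refl

-- A minimum clique cover of G₀, together with the triangle abc itself, is a
-- clique cover of G: every clique of G₀ is a clique of G, and the only edges of
-- G missing from G₀ are ab and ac, both inside the triangle.
module Submission where

open import Defs
open import Data.Bool using (Bool; true; false; T; _∧_; _∨_; not)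
open import Data.Bool.Properties using (T-∧; T-∨; T-≡; ∧-conicalˡ)
open import Data.Empty using (⊥-elim)
open import Data.Fin using (Fin; _≟_)
open import Data.Fin.Subset using (Subset; ⁅_⁆; _∪_) renaming (_∈_ to _∈ₛ_)
open import Data.Fin.Subset.Properties using (x∈⁅x⁆; x∈⁅y⁆⇒x≡y; x∈p∪q⁻; x∈p∪q⁺)
open import Data.List using (_∷_)
open import Data.List.Membership.Propositional renaming (_∈_ to _∈ₗ_)
open import Data.List.Relation.Unary.Any using (here; there)
open import Data.Nat using (ℕ; _≤_; _+_; suc)
open import Data.Nat.Properties using (+-comm)
open import Data.Product using (∃; _×_; _,_)
open import Data.Sum using (_⊎_; inj₁; inj₂)
import Data.Sum as Sum
open import Function using (_∘_)
open import Function.Bundles using (Equivalence)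
open import Relation.Binary.PropositionalEquality
  using (_≡_; _≢_; refl; cong; subst; trans)
open import Relation.Nullary.Decidable using (⌊_⌋; toWitness)

private
  variable
    n : ℕ

infix 4 _⊆ᴳ_

_⊆ᴳ_ : Graph n → Graph n → Set
H ⊆ᴳ G = ∀ u v → Adj H u v → Adj G u v

module _ {H G : Graph n} {S : Subset n}
         (H⊆G : H ⊆ᴳ G) (S-clique : IsClique G S)
         (new-edges-in-S : ∀ u v → Adj G u v → Adj H u v ⊎ (u ∈ₛ S × v ∈ₛ S))
         where

  cliqueCover-∷ : ∀ {𝒞} → IsCliqueCover H 𝒞 → IsCliqueCover G (S ∷ 𝒞)
  cliqueCover-∷ {𝒞} cover = record
    { cliques     = cliques′
    ; coversVerts = coversVerts′
    ; coversEdges = coversEdges′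
    }
    where
    open IsCliqueCover cover

    cliques′ : ∀ C → C ∈ₗ S ∷ 𝒞 → IsClique G C
    cliques′ C (here refl) = S-clique
    cliques′ C (there C∈𝒞) u v u∈C v∈C u≢v = H⊆G u v (cliques C C∈𝒞 u v u∈C v∈C u≢v)

    coversVerts′ : ∀ v → ∃ λ C → C ∈ₗ S ∷ 𝒞 × v ∈ₛ C
    coversVerts′ v with coversVerts v
    ... | C , C∈𝒞 , v∈C = C , there C∈𝒞 , v∈C

    coversEdges′ : ∀ u v → Adj G u v → ∃ λ C → C ∈ₗ S ∷ 𝒞 × u ∈ₛ C × v ∈ₛ C
    coversEdges′ u v uv with new-edges-in-S u v uv
    ... | inj₂ (u∈S , v∈S) = S , here refl , u∈S , v∈S
    ... | inj₁ uvᴴ with coversEdges u v uvᴴ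
    ...   | C , C∈𝒞 , u∈C , v∈C = C , there C∈𝒞 , u∈C , v∈C

  theta-≤-suc : ∀ {t t₀} → IsTheta G t → IsTheta H t₀ → t ≤ suc t₀
  theta-≤-suc (_ , minimal) ((𝒞 , cover , refl) , _) = minimal (S ∷ 𝒞) (cliqueCover-∷ cover)

triangle : Fin n → Fin n → Fin n → Subset n
triangle a b c = ⁅ a ⁆ ∪ ⁅ b ⁆ ∪ ⁅ c ⁆

module _ {a b c : Fin n} where

  ∈-triangle⁻ : ∀ {x} → x ∈ₛ triangle a b c → x ≡ a ⊎ x ≡ b ⊎ x ≡ c
  ∈-triangle⁻ x∈ =
    Sum.map (x∈⁅y⁆⇒x≡y a)
            (Sum.map (x∈⁅y⁆⇒x≡y b) (x∈⁅y⁆⇒x≡y c) ∘ x∈p∪q⁻ _ _)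
            (x∈p∪q⁻ _ _ x∈)

  ∈-triangle⁺ : ∀ {x} → x ≡ a ⊎ x ≡ b ⊎ x ≡ c → x ∈ₛ triangle a b c
  ∈-triangle⁺ (inj₁ refl)        = x∈p∪q⁺ (inj₁ (x∈⁅x⁆ a))
  ∈-triangle⁺ (inj₂ (inj₁ refl)) = x∈p∪q⁺ (inj₂ (x∈p∪q⁺ (inj₁ (x∈⁅x⁆ b))))
  ∈-triangle⁺ (inj₂ (inj₂ refl)) = x∈p∪q⁺ (inj₂ (x∈p∪q⁺ (inj₂ (x∈⁅x⁆ c))))

Adj-sym : (G : Graph n) → ∀ {u v} → Adj G u v → Adj G v u
Adj-sym G {u} {v} uv = trans (sym G v u) uv

triangle-isClique : (G : Graph n) {a b c : Fin n} →
  Adj G a b → Adj G a c → Adj G b c → IsClique G (triangle a b c)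
triangle-isClique G ab ac bc u v u∈ v∈ u≢v with ∈-triangle⁻ u∈ | ∈-triangle⁻ v∈
... | inj₁ refl        | inj₁ refl        = ⊥-elim (u≢v refl)
... | inj₁ refl        | inj₂ (inj₁ refl) = ab
... | inj₁ refl        | inj₂ (inj₂ refl) = ac
... | inj₂ (inj₁ refl) | inj₁ refl        = Adj-sym G ab
... | inj₂ (inj₁ refl) | inj₂ (inj₁ refl) = ⊥-elim (u≢v refl)
... | inj₂ (inj₁ refl) | inj₂ (inj₂ refl) = bc
... | inj₂ (inj₂ refl) | inj₁ refl        = Adj-sym G ac
... | inj₂ (inj₂ refl) | inj₂ (inj₁ refl) = Adj-sym G bc
... | inj₂ (inj₂ refl) | inj₂ (inj₂ refl) = ⊥-elim (u≢v refl)

module _ (G : Graph n) (a b c : Fin n) where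

  private
    -- the test for {u,v} ∈ {ab, ac}, copied from removeTwo so that
    -- adj (removeTwo G a b c) u v ≡ adj G u v ∧ not (removed u v) holds by refl
    isPair : Fin n → Fin n → Fin n → Fin n → Bool
    isPair x y u v = (⌊ u ≟ x ⌋ ∧ ⌊ v ≟ y ⌋) ∨ (⌊ u ≟ y ⌋ ∧ ⌊ v ≟ x ⌋)

    removed : Fin n → Fin n → Bool
    removed u v = isPair a b u v ∨ isPair a c u v

    isPair-∈ : ∀ {x y u v} → x ∈ₛ triangle a b c → y ∈ₛ triangle a b c →
               T (isPair x y u v) → u ∈ₛ triangle a b c × v ∈ₛ triangle a b c
    isPair-∈ {x} {y} {u} {v} x∈ y∈ p with Equivalence.to T-∨ p
    ... | inj₁ q with Equivalence.to T-∧ q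
    ...   | ux , vy rewrite toWitness {a? = u ≟ x} ux | toWitness {a? = v ≟ y} vy = x∈ , y∈
    isPair-∈ {x} {y} {u} {v} x∈ y∈ p | inj₂ q with Equivalence.to T-∧ q
    ...   | uy , vx rewrite toWitness {a? = u ≟ y} uy | toWitness {a? = v ≟ x} vx = y∈ , x∈

    removed-∈ : ∀ {u v} → T (removed u v) → u ∈ₛ triangle a b c × v ∈ₛ triangle a b c
    removed-∈ p with Equivalence.to T-∨ p
    ... | inj₁ q = isPair-∈ (∈-triangle⁺ (inj₁ refl)) (∈-triangle⁺ (inj₂ (inj₁ refl))) q
    ... | inj₂ q = isPair-∈ (∈-triangle⁺ (inj₁ refl)) (∈-triangle⁺ (inj₂ (inj₂ refl))) q

  removeTwo-⊆ : removeTwo G a b c ⊆ᴳ G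
  removeTwo-⊆ u v uv = ∧-conicalˡ _ _ uv

  removeTwo-edge : ∀ u v → Adj G u v →
    Adj (removeTwo G a b c) u v ⊎ (u ∈ₛ triangle a b c × v ∈ₛ triangle a b c)
  removeTwo-edge u v uv with removed u v in eq
  ... | true  = inj₂ (removed-∈ (Equivalence.from T-≡ eq))
  ... | false = inj₁ (cong (_∧ true) uv)

claim13 : ∀ {n} (G : Graph n) (a b c : Fin n) →
    a ≢ b → a ≢ c → b ≢ c →
    Adj G a b → Adj G a c → Adj G b c →
    ∀ t t₀ → IsTheta G t → IsTheta (removeTwo G a b c) t₀ →
    t ≤ t₀ + 1
claim13 G a b c _ _ _ ab ac bc t t₀ θG θG₀ =
  subst (t ≤_) (+-comm 1 t₀)
    (theta-≤-suc (removeTwo-⊆ G a b c) (triangle-isClique G ab ac bc)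
                 (removeTwo-edge G a b c) θG θG₀)
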